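{- Let $e$ and $f$ be atomic expressions, i.e. each is either a well-formed power term $S.\mathbf{P}_U$ or one of the constants $S_\emptyset.\mathbf{P}_\emptyset$, $S_I.\mathbf{P}_\emptyset$. Then there exists a power term polynomial $\pi$ containing at most three atomic terms (each a well-formed power term or one of the two constants) such that $[\![\pi]\!]=[\![e]\!]\cdot[\![f]\!]$, i.e. the product $e\odot f$ is semantically equivalent to $\pi$.
   Context: Let $\mathcal{D}=\{x_1,\dots,x_n\}$ be Boolean variables and consider Boolean polynomials in $\mathbb{F}_2[x_1,\dots,x_n]/(x_i^2-x_i: i\in[n])$, with product denoted $\cdot$. For $W\subseteq\mathcal{D}$ let $m_W=\prod_{x\in W}x$ ($m_\emptyset=1$). For $U\subseteq\mathcal{D}$ the modified power set is $\mathbf{P}_U=\{\emptyset\}$ if $U=\emptyset$ and $\mathbf{P}_U=\{A\subseteq U: A\neq\emptyset\}$ otherwise. A well-formed power term is $S.\mathbf{P}_U$ with $S,U\subseteq\mathcal{D}$, $S\cap U=\emptyset$, $|U|\neq 1$, $(S,U)\neq(\emptyset,\emptyset)$; its semantics is $[\![S.\mathbf{P}_U]\!]=\sum_{A\in\mathbf{P}_U}m_{S\cup A}$. The constants $S_\emptyset.\mathbf{P}_\emptyset$ and $S_I.\mathbf{P}_\emptyset$ have semantics $0$ and $1$. A power term polynomial is a formal expression built from atomic terms by a commutative, associative operator $\uplus$ with identity $S_\emptyset.\mathbf{P}_\emptyset$ and $\pi\uplus\pi=S_\emptyset.\mathbf{P}_\emptyset$, with semantics $[\![\pi\uplus\rho]\!]=[\![\pi]\!]+[\![\rho]\!]$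 over $\mathbb{F}_2$. The product operator $\odot$ on expressions has semantics $[\![e\odot f]\!]=[\![e]\!]\cdot[\![f]\!]$. -}

module Defs where

open import Data.Nat using (ℕ; suc; zero)
open import Data.Bool using (Bool; true; false; _xor_; if_then_else_)
import Data.Bool as B
open import Data.Fin.Subset using (Subset; ⊥; ⊤; _∪_; _∩_; ∣_∣)
open import Data.Vec using (Vec; []; _∷_)
open import Data.Vec.Properties using (≡-dec)
open import Data.List using (List; []; _∷_; map; _++_; concatMap; filter; foldr)
open import Data.Product using (_×_)
open import Relation.Binary.PropositionalEquality using (_≡_)
open import Relation.Nullary using (¬_; Dec; yes; no; does)
open import Relation.Nullary.Decidable using (¬?)

-- Boolean variables x₁,…,xₙ are indexed by Fin n; a set W ⊆ D is a Subset n.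
-- A Boolean polynomial (element of F₂[x]/(xᵢ²-xᵢ)) is represented by a formal
-- list of monomials m_W (a formal F₂-sum); two polynomials are equal iff all
-- their F₂-coefficients agree (see _≈ₚ_).

_≟ₛ_ : ∀ {n} (A B : Subset n) → Dec (A ≡ B)
_≟ₛ_ = ≡-dec B._≟_

BPoly : ℕ → Set
BPoly n = List (Subset n)

coef : ∀ {n} → BPoly n → Subset n → Bool
coef p W = foldr (λ A b → does (A ≟ₛ W) xor b) false p

_≈ₚ_ : ∀ {n} → BPoly n → BPoly n → Set
p ≈ₚ q = ∀ W → coef p W ≡ coef q W

-- sum and product of Boolean polynomials (m_A · m_B = m_{A ∪ B} since xᵢ² = xᵢ)
_+ₚ_ : ∀ {n} → BPoly n → BPoly n → BPoly n
p +ₚ q = p ++ q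

_·ₚ_ : ∀ {n} → BPoly n → BPoly n → BPoly n
p ·ₚ q = concatMap (λ A → map (λ B → A ∪ B) q) p

subsetsOf : ∀ {n} → Subset n → List (Subset n)
subsetsOf [] = [] ∷ []
subsetsOf (false ∷ u) = map (false ∷_) (subsetsOf u)
subsetsOf (true ∷ u) = map (false ∷_) (subsetsOf u) ++ map (true ∷_) (subsetsOf u)

PSet : ∀ {n} → Subset n → List (Subset n)
PSet U with U ≟ₛ ⊥
... | yes _ = ⊥ ∷ []
... | no _ = filter (λ A → ¬? (A ≟ₛ ⊥)) (subsetsOf U)

WellFormed : ∀ {n} → Subset n → Subset n → Set
WellFormed S U = (S ∩ U ≡ ⊥) × (¬ (∣ U ∣ ≡ 1)) × (¬ ((S ≡ ⊥) × (U ≡ ⊥)))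

data Atom (n : ℕ) : Set where
  S∅P∅ : Atom n
  SIP∅ : Atom n
  pt   : (S U : Subset n) → WellFormed S U → Atom n

⟦_⟧ₐ : ∀ {n} → Atom n → BPoly n
⟦ S∅P∅ ⟧ₐ = []
⟦ SIP∅ ⟧ₐ = ⊥ ∷ []
⟦ pt S U _ ⟧ₐ = map (λ A → S ∪ A) (PSet U)

PTPoly : ℕ → Set
PTPoly n = List (Atom n)

⟦_⟧ : ∀ {n} → PTPoly n → BPoly n
⟦ π ⟧ = foldr (λ a p → ⟦ a ⟧ₐ +ₚ p) [] π

-- As a function on {0,1}ⁿ, S.P_U is m_S · ⋁_{u ∈ U} x_u (just m_S when U = ∅), and a
-- Boolean polynomial is determined by its truth table (split off one variable at a time).
-- In the product m_S ⋁U · m_T ⋁V the factor ⋁U is absorbed by m_T when T meets U and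
-- otherwise stays disjoint from S ∪ T; likewise for ⋁V. What remains is m_{S∪T} · a · b with
-- a, b ∈ {1, ⋁U, ⋁V}, and a b = a + b + (a ∨ b) over 𝔽₂ with ⋁U ∨ ⋁V = ⋁(U ∪ V) gives
-- at most three power terms.
module Submission where

open import Defs
open import Data.Nat using (ℕ; zero; suc; _≤_; z≤n; s≤s)
open import Data.Bool using (Bool; true; false; not; _∧_; _∨_; _xor_)
open import Data.Bool.Properties
  using (∧-assoc; ∧-zeroʳ; ∧-identityʳ; ∧-distribˡ-xor; ∧-distribʳ-xor; ∨-assoc; ∨-zeroʳ;
         xor-assoc; xor-comm; xor-identityʳ; xor-same; xor-annihilates-not;
         not-distribʳ-xor; not-involutive)
open import Data.Fin.Subset using (Subset; ⊥; _∪_; _∩_; ∣_∣; _⊆_)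
open import Data.Fin.Subset.Properties
  using (∣⊥∣≡0; ∣p∣≤∣p∪q∣; p⊆p∪q; ⊥⊆; ⊆-antisym; ∩-zeroʳ; ∩-distribˡ-∪; ∩-distribʳ-∪;
         ∪-identityˡ; ∪-comm)
open import Data.List using ([]; _∷_; _++_; map; filter; foldr; length)
open import Data.Vec using (Vec; []; _∷_)
open import Data.Product using (∃-syntax; _×_; _,_; proj₁; proj₂)
open import Data.Sum using (_⊎_; inj₁; inj₂)
open import Relation.Binary.PropositionalEquality
open import Function using (_∘_)
open import Relation.Nullary using (¬_; Dec; yes; no; does; contradiction)
open import Relation.Nullary.Decidable using (¬?)

∣p∣≡0⇒p≡⊥ : ∀ {n} (p : Subset n) → ∣ p ∣ ≡ 0 → p ≡ ⊥
∣p∣≡0⇒p≡⊥ []          _ = refl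
∣p∣≡0⇒p≡⊥ (false ∷ p) e = cong (false ∷_) (∣p∣≡0⇒p≡⊥ p e)

∣⊥∣≢1 : ∀ {n} → ¬ (∣ ⊥ {n} ∣ ≡ 1)
∣⊥∣≢1 {n} e with trans (sym (∣⊥∣≡0 n)) e
... | ()

p∪q≢⊥ : ∀ {n} {p : Subset n} q → ¬ (p ≡ ⊥) → ¬ (p ∪ q ≡ ⊥)
p∪q≢⊥ {p = p} q p≢⊥ p∪q≡⊥ = p≢⊥ (⊆-antisym (subst (p ⊆_) p∪q≡⊥ (p⊆p∪q q)) ⊥⊆)

∣p∪q∣≢1 : ∀ {n} {p : Subset n} q → ¬ (p ≡ ⊥) → ¬ (∣ p ∣ ≡ 1) → ¬ (∣ p ∪ q ∣ ≡ 1)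
∣p∪q∣≢1 {p = p} q p≢⊥ ∣p∣≢1 ∣p∪q∣≡1 with ∣ p ∣ in eq | ∣p∣≤∣p∪q∣ p q
... | 0           | _  = p≢⊥ (∣p∣≡0⇒p≡⊥ p eq)
... | 1           | _  = ∣p∣≢1 refl
... | suc (suc k) | le with subst (suc (suc k) ≤_) ∣p∪q∣≡1 le
...   | s≤s ()

disjoint-∪ˡ : ∀ {n} {S T U : Subset n} → S ∩ U ≡ ⊥ → T ∩ U ≡ ⊥ → (S ∪ T) ∩ U ≡ ⊥
disjoint-∪ˡ {S = S} {T} {U} S∩U≡⊥ T∩U≡⊥ = begin
  (S ∪ T) ∩ U       ≡⟨ ∩-distribʳ-∪ U S T ⟩
  (S ∩ U) ∪ (T ∩ U) ≡⟨ cong₂ _∪_ S∩U≡⊥ T∩U≡⊥ ⟩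
  ⊥ ∪ ⊥             ≡⟨ ∪-identityˡ ⊥ ⟩
  ⊥                 ∎
  where open ≡-Reasoning

disjoint-∪ʳ : ∀ {n} {R U V : Subset n} → R ∩ U ≡ ⊥ → R ∩ V ≡ ⊥ → R ∩ (U ∪ V) ≡ ⊥
disjoint-∪ʳ {R = R} {U} {V} R∩U≡⊥ R∩V≡⊥ = begin
  R ∩ (U ∪ V)       ≡⟨ ∩-distribˡ-∪ R U V ⟩
  (R ∩ U) ∪ (R ∩ V) ≡⟨ cong₂ _∪_ R∩U≡⊥ R∩V≡⊥ ⟩
  ⊥ ∪ ⊥             ≡⟨ ∪-identityˡ ⊥ ⟩
  ⊥                 ∎
  where open ≡-Reasoning

monomial : ∀ {n} → Subset n → Vec Bool n → Bool
monomial []          []      = true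
monomial (false ∷ A) (_ ∷ x) = monomial A x
monomial (true ∷ A)  (b ∷ x) = b ∧ monomial A x

meets : ∀ {n} → Subset n → Vec Bool n → Bool
meets []          []      = false
meets (false ∷ U) (_ ∷ x) = meets U x
meets (true ∷ U)  (b ∷ x) = b ∨ meets U x

eval : ∀ {n} → BPoly n → Vec Bool n → Bool
eval p x = foldr (λ A r → monomial A x xor r) false p

-- The value of ∑_{A ∈ P_U} m_A, which is 1 + ∏_{u ∈ U} (1 + x_u) when U is nonempty.
powerSum : ∀ {n} → Subset n → Vec Bool n → Bool
powerSum U x = does (U ≟ₛ ⊥) ∨ meets U x

monomial-⊥ : ∀ {n} (x : Vec Bool n) → monomial ⊥ x ≡ true
monomial-⊥ []      = refl
monomial-⊥ (_ ∷ x) = monomial-⊥ x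

monomial-∪ : ∀ {n} (A B : Subset n) x → monomial (A ∪ B) x ≡ monomial A x ∧ monomial B x
monomial-∪ []          []          []          = refl
monomial-∪ (false ∷ A) (false ∷ B) (_ ∷ x)     = monomial-∪ A B x
monomial-∪ (false ∷ A) (true ∷ B)  (false ∷ x) = sym (∧-zeroʳ (monomial A x))
monomial-∪ (false ∷ A) (true ∷ B)  (true ∷ x)  = monomial-∪ A B x
monomial-∪ (true ∷ A)  (false ∷ B) (b ∷ x)     =
  trans (cong (b ∧_) (monomial-∪ A B x)) (sym (∧-assoc b _ _))
monomial-∪ (true ∷ A)  (true ∷ B)  (false ∷ x) = refl
monomial-∪ (true ∷ A)  (true ∷ B)  (true ∷ x)  = monomial-∪ A B x

meets-∪ : ∀ {n} (U V : Subset n) x → meets (U ∪ V) x ≡ meets U x ∨ meets V x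
meets-∪ []          []          []          = refl
meets-∪ (false ∷ U) (false ∷ V) (_ ∷ x)     = meets-∪ U V x
meets-∪ (false ∷ U) (true ∷ V)  (false ∷ x) = meets-∪ U V x
meets-∪ (false ∷ U) (true ∷ V)  (true ∷ x)  = sym (∨-zeroʳ (meets U x))
meets-∪ (true ∷ U)  (false ∷ V) (b ∷ x)     =
  trans (cong (b ∨_) (meets-∪ U V x)) (sym (∨-assoc b _ _))
meets-∪ (true ∷ U)  (true ∷ V)  (false ∷ x) = meets-∪ U V x
meets-∪ (true ∷ U)  (true ∷ V)  (true ∷ x)  = refl

meets-if-monomial : ∀ {n} (T U : Subset n) x → ¬ (T ∩ U ≡ ⊥) →
  monomial T x ≡ true → meets U x ≡ true
meets-if-monomial []          []          []          T∩U≢⊥ _ = contradiction refl T∩U≢⊥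
meets-if-monomial (true ∷ T)  (true ∷ U)  (true ∷ x)  _     _ = refl
meets-if-monomial (true ∷ T)  (false ∷ U) (true ∷ x)  T∩U≢⊥ h =
  meets-if-monomial T U x (T∩U≢⊥ ∘ cong (false ∷_)) h
meets-if-monomial (false ∷ T) (false ∷ U) (_ ∷ x)     T∩U≢⊥ h =
  meets-if-monomial T U x (T∩U≢⊥ ∘ cong (false ∷_)) h
meets-if-monomial (false ∷ T) (true ∷ U)  (b ∷ x)     T∩U≢⊥ h =
  trans (cong (b ∨_) (meets-if-monomial T U x (T∩U≢⊥ ∘ cong (false ∷_)) h)) (∨-zeroʳ b)

monomial-absorbs-meets : ∀ {n} (T U : Subset n) x → ¬ (T ∩ U ≡ ⊥) →
  monomial T x ∧ meets U x ≡ monomial T x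
monomial-absorbs-meets T U x T∩U≢⊥ with monomial T x in eq
... | false = refl
... | true  = meets-if-monomial T U x T∩U≢⊥ eq

eval-++ : ∀ {n} (p q : BPoly n) x → eval (p ++ q) x ≡ eval p x xor eval q x
eval-++ []      q x = refl
eval-++ (A ∷ p) q x =
  trans (cong (monomial A x xor_) (eval-++ p q x)) (sym (xor-assoc (monomial A x) _ _))

eval-map-∪ : ∀ {n} (A : Subset n) (p : BPoly n) x →
  eval (map (A ∪_) p) x ≡ monomial A x ∧ eval p x
eval-map-∪ A []      x = sym (∧-zeroʳ (monomial A x))
eval-map-∪ A (B ∷ p) x = begin
  monomial (A ∪ B) x xor eval (map (A ∪_) p) x
    ≡⟨ cong₂ _xor_ (monomial-∪ A B x) (eval-map-∪ A p x) ⟩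
  (monomial A x ∧ monomial B x) xor (monomial A x ∧ eval p x)
    ≡⟨ sym (∧-distribˡ-xor (monomial A x) _ _) ⟩
  monomial A x ∧ (monomial B x xor eval p x) ∎
  where open ≡-Reasoning

eval-·ₚ : ∀ {n} (p q : BPoly n) x → eval (p ·ₚ q) x ≡ eval p x ∧ eval q x
eval-·ₚ []      q x = refl
eval-·ₚ (A ∷ p) q x = begin
  eval (map (A ∪_) q ++ (p ·ₚ q)) x
    ≡⟨ eval-++ (map (A ∪_) q) (p ·ₚ q) x ⟩
  eval (map (A ∪_) q) x xor eval (p ·ₚ q) x
    ≡⟨ cong₂ _xor_ (eval-map-∪ A q x) (eval-·ₚ p q x) ⟩
  (monomial A x ∧ eval q x) xor (eval p x ∧ eval q x)
    ≡⟨ sym (∧-distribʳ-xor (eval q x) (monomial A x) (eval p x)) ⟩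
  (monomial A x xor eval p x) ∧ eval q x ∎
  where open ≡-Reasoning

-- p = cofactor p + x₀ · derivative p, with x₀ removed from both.
cofactor : ∀ {n} → BPoly (suc n) → BPoly n
cofactor []                = []
cofactor ((false ∷ A) ∷ p) = A ∷ cofactor p
cofactor ((true ∷ A) ∷ p)  = cofactor p

derivative : ∀ {n} → BPoly (suc n) → BPoly n
derivative []                = []
derivative ((false ∷ A) ∷ p) = derivative p
derivative ((true ∷ A) ∷ p)  = A ∷ derivative p

eval-cofactor : ∀ {n} (p : BPoly (suc n)) x → eval (cofactor p) x ≡ eval p (false ∷ x)
eval-cofactor []                x = refl
eval-cofactor ((false ∷ A) ∷ p) x = cong (monomial A x xor_) (eval-cofactor p x)
eval-cofactor ((true ∷ A) ∷ p)  x = eval-cofactor p x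

eval-derivative : ∀ {n} (p : BPoly (suc n)) x →
  eval (derivative p) x ≡ eval p (false ∷ x) xor eval p (true ∷ x)
eval-derivative []                x = refl
eval-derivative ((false ∷ A) ∷ p) x =
  trans (eval-derivative p x) (sym (xor-cancelˡ (monomial A x) _ _))
  where
  xor-cancelˡ : ∀ m a b → (m xor a) xor (m xor b) ≡ a xor b
  xor-cancelˡ false a b = refl
  xor-cancelˡ true  a b = xor-annihilates-not a b
eval-derivative ((true ∷ A) ∷ p)  x =
  trans (cong (monomial A x xor_) (eval-derivative p x))
        (xor-swapˡ (monomial A x) (eval p (false ∷ x)) (eval p (true ∷ x)))
  where
  xor-swapˡ : ∀ m a b → m xor (a xor b) ≡ a xor (m xor b)
  xor-swapˡ false a b = refl
  xor-swapˡ true  a b = not-distribʳ-xor a b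

coef-cofactor : ∀ {n} (p : BPoly (suc n)) W → coef p (false ∷ W) ≡ coef (cofactor p) W
coef-cofactor []                W = refl
coef-cofactor ((false ∷ A) ∷ p) W = cong (does (A ≟ₛ W) xor_) (coef-cofactor p W)
coef-cofactor ((true ∷ A) ∷ p)  W = coef-cofactor p W

coef-derivative : ∀ {n} (p : BPoly (suc n)) W → coef p (true ∷ W) ≡ coef (derivative p) W
coef-derivative []                W = refl
coef-derivative ((false ∷ A) ∷ p) W = coef-derivative p W
coef-derivative ((true ∷ A) ∷ p)  W = cong (does (A ≟ₛ W) xor_) (coef-derivative p W)

coef≡eval : (p : BPoly 0) → coef p [] ≡ eval p []
coef≡eval []       = refl
coef≡eval ([] ∷ p) = cong not (coef≡eval p)

eval-injective : ∀ {n} (p q : BPoly n) → (∀ x → eval p x ≡ eval q x) → p ≈ₚ q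
eval-injective {zero}  p q h [] = trans (coef≡eval p) (trans (h []) (sym (coef≡eval q)))
eval-injective {suc n} p q h (false ∷ W) =
  trans (coef-cofactor p W) (trans (eval-injective (cofactor p) (cofactor q) h₀ W)
                                   (sym (coef-cofactor q W)))
  where
  h₀ : ∀ x → eval (cofactor p) x ≡ eval (cofactor q) x
  h₀ x = trans (eval-cofactor p x) (trans (h (false ∷ x)) (sym (eval-cofactor q x)))
eval-injective {suc n} p q h (true ∷ W) =
  trans (coef-derivative p W) (trans (eval-injective (derivative p) (derivative q) h₁ W)
                                     (sym (coef-derivative q W)))
  where
  h₁ : ∀ x → eval (derivative p) x ≡ eval (derivative q) x
  h₁ x = trans (eval-derivative p x)
           (trans (cong₂ _xor_ (h (false ∷ x)) (h (true ∷ x))) (sym (eval-derivative q x)))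

eval-map-false∷ : ∀ {n} (p : BPoly n) b x → eval (map (false ∷_) p) (b ∷ x) ≡ eval p x
eval-map-false∷ []      b x = refl
eval-map-false∷ (A ∷ p) b x = cong (monomial A x xor_) (eval-map-false∷ p b x)

eval-map-true∷ : ∀ {n} (p : BPoly n) b x → eval (map (true ∷_) p) (b ∷ x) ≡ b ∧ eval p x
eval-map-true∷ []      b x = sym (∧-zeroʳ b)
eval-map-true∷ (A ∷ p) b x =
  trans (cong (b ∧ monomial A x xor_) (eval-map-true∷ p b x)) (sym (∧-distribˡ-xor b _ _))

coef-map-false∷ : ∀ {n} (p : BPoly n) W → coef (map (false ∷_) p) (false ∷ W) ≡ coef p W
coef-map-false∷ []      W = refl
coef-map-false∷ (A ∷ p) W = cong (does (A ≟ₛ W) xor_) (coef-map-false∷ p W)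

coef-map-true∷ : ∀ {n} (p : BPoly n) W → coef (map (true ∷_) p) (false ∷ W) ≡ false
coef-map-true∷ []      W = refl
coef-map-true∷ (A ∷ p) W = coef-map-true∷ p W

coef-++ : ∀ {n} (p q : BPoly n) W → coef (p ++ q) W ≡ coef p W xor coef q W
coef-++ []      q W = refl
coef-++ (A ∷ p) q W =
  trans (cong (does (A ≟ₛ W) xor_) (coef-++ p q W)) (sym (xor-assoc (does (A ≟ₛ W)) _ _))

eval-subsetsOf : ∀ {n} (U : Subset n) x → eval (subsetsOf U) x ≡ not (meets U x)
eval-subsetsOf []          []      = refl
eval-subsetsOf (false ∷ U) (b ∷ x) =
  trans (eval-map-false∷ (subsetsOf U) b x) (eval-subsetsOf U x)
eval-subsetsOf (true ∷ U)  (b ∷ x) = begin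
  eval (map (false ∷_) (subsetsOf U) ++ map (true ∷_) (subsetsOf U)) (b ∷ x)
    ≡⟨ eval-++ (map (false ∷_) (subsetsOf U)) _ (b ∷ x) ⟩
  eval (map (false ∷_) (subsetsOf U)) (b ∷ x) xor eval (map (true ∷_) (subsetsOf U)) (b ∷ x)
    ≡⟨ cong₂ _xor_ (eval-map-false∷ (subsetsOf U) b x) (eval-map-true∷ (subsetsOf U) b x) ⟩
  eval (subsetsOf U) x xor (b ∧ eval (subsetsOf U) x)
    ≡⟨ cong (λ e → e xor (b ∧ e)) (eval-subsetsOf U x) ⟩
  not (meets U x) xor (b ∧ not (meets U x))
    ≡⟨ xor-∧-not b (meets U x) ⟩
  not (b ∨ meets U x) ∎
  where
  open ≡-Reasoning
  xor-∧-not : ∀ b m → not m xor (b ∧ not m) ≡ not (b ∨ m)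
  xor-∧-not false m = xor-identityʳ (not m)
  xor-∧-not true  m = xor-same (not m)

coef-subsetsOf-⊥ : ∀ {n} (U : Subset n) → coef (subsetsOf U) ⊥ ≡ true
coef-subsetsOf-⊥ []          = refl
coef-subsetsOf-⊥ (false ∷ U) = trans (coef-map-false∷ (subsetsOf U) ⊥) (coef-subsetsOf-⊥ U)
coef-subsetsOf-⊥ (true ∷ U)  = begin
  coef (map (false ∷_) (subsetsOf U) ++ map (true ∷_) (subsetsOf U)) ⊥
    ≡⟨ coef-++ (map (false ∷_) (subsetsOf U)) _ ⊥ ⟩
  coef (map (false ∷_) (subsetsOf U)) ⊥ xor coef (map (true ∷_) (subsetsOf U)) ⊥
    ≡⟨ cong₂ _xor_ (coef-map-false∷ (subsetsOf U) ⊥) (coef-map-true∷ (subsetsOf U) ⊥) ⟩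
  coef (subsetsOf U) ⊥ xor false
    ≡⟨ xor-identityʳ _ ⟩
  coef (subsetsOf U) ⊥
    ≡⟨ coef-subsetsOf-⊥ U ⟩
  true ∎
  where open ≡-Reasoning

eval-filter-nonempty : ∀ {n} (p : BPoly n) x →
  eval (filter (λ A → ¬? (A ≟ₛ ⊥)) p) x ≡ eval p x xor coef p ⊥
eval-filter-nonempty []      x = refl
eval-filter-nonempty (A ∷ p) x with A ≟ₛ ⊥
... | yes refl rewrite monomial-⊥ x =
  trans (eval-filter-nonempty p x) (sym (xor-annihilates-not (eval p x) (coef p ⊥)))
... | no _ =
  trans (cong (monomial A x xor_) (eval-filter-nonempty p x)) (sym (xor-assoc (monomial A x) _ _))

eval-PSet : ∀ {n} (U : Subset n) x → eval (PSet U) x ≡ powerSum U x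
eval-PSet U x with U ≟ₛ ⊥
... | yes refl = cong (_xor false) (monomial-⊥ x)
... | no _     = begin
  eval (filter (λ A → ¬? (A ≟ₛ ⊥)) (subsetsOf U)) x
    ≡⟨ eval-filter-nonempty (subsetsOf U) x ⟩
  eval (subsetsOf U) x xor coef (subsetsOf U) ⊥
    ≡⟨ cong₂ _xor_ (eval-subsetsOf U x) (coef-subsetsOf-⊥ U) ⟩
  not (meets U x) xor true
    ≡⟨ xor-comm (not (meets U x)) true ⟩
  not (not (meets U x))
    ≡⟨ not-involutive (meets U x) ⟩
  meets U x ∎
  where open ≡-Reasoning

powerSum-empty : ∀ {n} {U : Subset n} x → U ≡ ⊥ → powerSum U x ≡ true
powerSum-empty {U = U} x U≡⊥ with U ≟ₛ ⊥
... | yes _   = refl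
... | no U≢⊥ = contradiction U≡⊥ U≢⊥

powerSum-nonempty : ∀ {n} {U : Subset n} x → ¬ (U ≡ ⊥) → powerSum U x ≡ meets U x
powerSum-nonempty {U = U} x U≢⊥ with U ≟ₛ ⊥
... | yes U≡⊥ = contradiction U≡⊥ U≢⊥
... | no _    = refl

eval-pt : ∀ {n} (S U : Subset n) (w : WellFormed S U) x →
  eval ⟦ pt S U w ⟧ₐ x ≡ monomial S x ∧ powerSum U x
eval-pt S U w x = trans (eval-map-∪ S (PSet U) x) (cong (monomial S x ∧_) (eval-PSet U x))

eval-⟦⟧ : ∀ {n} (π : PTPoly n) x → eval ⟦ π ⟧ x ≡ foldr (λ a r → eval ⟦ a ⟧ₐ x xor r) false π
eval-⟦⟧ []      x = refl
eval-⟦⟧ (a ∷ π) x = trans (eval-++ ⟦ a ⟧ₐ ⟦ π ⟧ x) (cong (eval ⟦ a ⟧ₐ x xor_) (eval-⟦⟧ π x))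

-- Power terms without the side condition (S, U) ≠ (∅, ∅), so that the constant 1 is one too.
record PowerTermShape {n} (f : Vec Bool n → Bool) : Set where
  constructor shape
  field
    base support  : Subset n
    disjoint      : base ∩ support ≡ ⊥
    nonSingleton  : ¬ (∣ support ∣ ≡ 1)
    eval≗         : ∀ x → f x ≡ monomial base x ∧ powerSum support x

Representable : ∀ {n} → (Vec Bool n → Bool) → Set
Representable f = ∃[ π ] (length π ≤ 3 × (∀ x → eval ⟦ π ⟧ x ≡ f x))

representable-≗ : ∀ {n} {f g : Vec Bool n → Bool} →
  Representable f → (∀ x → f x ≡ g x) → Representable g
representable-≗ (π , |π|≤3 , π≗f) f≗g = π , |π|≤3 , λ x → trans (π≗f x) (f≗g x)

atomShape : ∀ {n} (a : Atom n) → (∀ x → eval ⟦ a ⟧ₐ x ≡ false) ⊎ PowerTermShape (eval ⟦ a ⟧ₐ)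
atomShape S∅P∅                  = inj₁ λ _ → refl
atomShape {n} SIP∅              = inj₂ (shape ⊥ ⊥ (∩-zeroʳ ⊥) (∣⊥∣≢1 {n}) λ x →
  trans (cong (_xor false) (monomial-⊥ x)) (sym (cong₂ _∧_ (monomial-⊥ x) (powerSum-empty x refl))))
atomShape (pt S U w@(d , c , _)) = inj₂ (shape S U d c (eval-pt S U w))

powerTerm : ∀ {n} (R V : Subset n) → R ∩ V ≡ ⊥ → ¬ (∣ V ∣ ≡ 1) → Atom n
powerTerm R V d c with R ≟ₛ ⊥ | V ≟ₛ ⊥
... | yes _  | yes _  = SIP∅
... | no R≢⊥ | _      = pt R V (d , c , R≢⊥ ∘ proj₁)
... | yes _  | no V≢⊥ = pt R V (d , c , V≢⊥ ∘ proj₂)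

eval-powerTerm : ∀ {n} (R V : Subset n) d c x →
  eval ⟦ powerTerm R V d c ⟧ₐ x ≡ monomial R x ∧ powerSum V x
eval-powerTerm R V d c x with R ≟ₛ ⊥ | V ≟ₛ ⊥
... | yes refl | yes refl rewrite monomial-⊥ x = refl
... | yes refl | no V≢⊥   =
  trans (eval-pt R V (d , c , V≢⊥ ∘ proj₂) x) (cong (monomial R x ∧_) (powerSum-nonempty x V≢⊥))
... | no R≢⊥   | yes refl =
  trans (eval-pt R V (d , c , R≢⊥ ∘ proj₁) x) (cong (monomial R x ∧_) (powerSum-empty x refl))
... | no R≢⊥   | no V≢⊥   =
  trans (eval-pt R V (d , c , R≢⊥ ∘ proj₁) x) (cong (monomial R x ∧_) (powerSum-nonempty x V≢⊥))

powerTerm-representable : ∀ {n} (R V : Subset n) → R ∩ V ≡ ⊥ → ¬ (∣ V ∣ ≡ 1) →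
  Representable (λ x → monomial R x ∧ powerSum V x)
powerTerm-representable R V d c =
  powerTerm R V d c ∷ [] , s≤s z≤n ,
  λ x → trans (eval-⟦⟧ (powerTerm R V d c ∷ []) x)
                (trans (xor-identityʳ _) (eval-powerTerm R V d c x))

sameBase-product : ∀ {n} {R : Subset n} (U V : Subset n) → R ∩ U ≡ ⊥ → R ∩ V ≡ ⊥ →
  ¬ (∣ U ∣ ≡ 1) → ¬ (∣ V ∣ ≡ 1) →
  Representable (λ x → monomial R x ∧ (powerSum U x ∧ powerSum V x))
sameBase-product {n} {R} U V dU dV cU cV = byEmptiness (U ≟ₛ ⊥) (V ≟ₛ ⊥)
  where
  open ≡-Reasoning
  ∧-via-xor-∨ : ∀ r a b → (r ∧ a) xor ((r ∧ b) xor ((r ∧ (a ∨ b)) xor false)) ≡ r ∧ (a ∧ b)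
  ∧-via-xor-∨ false a     b     = refl
  ∧-via-xor-∨ true  false false = refl
  ∧-via-xor-∨ true  false true  = refl
  ∧-via-xor-∨ true  true  false = refl
  ∧-via-xor-∨ true  true  true  = refl

  byEmptiness : Dec (U ≡ ⊥) → Dec (V ≡ ⊥) →
    Representable (λ x → monomial R x ∧ (powerSum U x ∧ powerSum V x))
  byEmptiness (yes U≡⊥) _ = representable-≗ (powerTerm-representable R V dV cV) λ x →
    cong (λ b → monomial R x ∧ (b ∧ powerSum V x)) (sym (powerSum-empty x U≡⊥))
  byEmptiness (no _) (yes V≡⊥) = representable-≗ (powerTerm-representable R U dU cU) λ x →
    cong (monomial R x ∧_) (trans (sym (∧-identityʳ (powerSum U x)))
                                  (cong (powerSum U x ∧_) (sym (powerSum-empty x V≡⊥))))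
  byEmptiness (no U≢⊥) (no V≢⊥) =
    terms , s≤s (s≤s (s≤s z≤n)) , λ x → begin
      eval ⟦ terms ⟧ x
        ≡⟨ eval-⟦⟧ terms x ⟩
      eval ⟦ powerTerm R U dU cU ⟧ₐ x xor (eval ⟦ powerTerm R V dV cV ⟧ₐ x
        xor (eval ⟦ powerTerm R (U ∪ V) dUV cUV ⟧ₐ x xor false))
        ≡⟨ cong₂ _xor_ (eval-meets U dU cU U≢⊥ x) (cong₂ _xor_ (eval-meets V dV cV V≢⊥ x)
             (cong (_xor false) (trans (eval-meets (U ∪ V) dUV cUV (p∪q≢⊥ V U≢⊥) x)
                                       (cong (monomial R x ∧_) (meets-∪ U V x))))) ⟩
      (monomial R x ∧ meets U x) xor ((monomial R x ∧ meets V x)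
        xor ((monomial R x ∧ (meets U x ∨ meets V x)) xor false))
        ≡⟨ ∧-via-xor-∨ (monomial R x) (meets U x) (meets V x) ⟩
      monomial R x ∧ (meets U x ∧ meets V x)
        ≡⟨ cong (monomial R x ∧_)
             (sym (cong₂ _∧_ (powerSum-nonempty x U≢⊥) (powerSum-nonempty x V≢⊥))) ⟩
      monomial R x ∧ (powerSum U x ∧ powerSum V x) ∎
    where
    dUV : R ∩ (U ∪ V) ≡ ⊥
    dUV = disjoint-∪ʳ dU dV
    cUV : ¬ (∣ U ∪ V ∣ ≡ 1)
    cUV = ∣p∪q∣≢1 V U≢⊥ cU
    terms : PTPoly n
    terms = powerTerm R U dU cU ∷ powerTerm R V dV cV ∷ powerTerm R (U ∪ V) dUV cUV ∷ []
    eval-meets : ∀ W d c → ¬ (W ≡ ⊥) → ∀ x →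
      eval ⟦ powerTerm R W d c ⟧ₐ x ≡ monomial R x ∧ meets W x
    eval-meets W d c W≢⊥ x =
      trans (eval-powerTerm R W d c x) (cong (monomial R x ∧_) (powerSum-nonempty x W≢⊥))

absorbMonomial : ∀ {n} {S U : Subset n} (T : Subset n) → S ∩ U ≡ ⊥ → ¬ (∣ U ∣ ≡ 1) →
  ∃[ U′ ] ((S ∪ T) ∩ U′ ≡ ⊥ × ¬ (∣ U′ ∣ ≡ 1) ×
           (∀ x → monomial T x ∧ powerSum U x ≡ monomial T x ∧ powerSum U′ x))
absorbMonomial {n} {S} {U} T S∩U≡⊥ ∣U∣≢1 with (T ∩ U) ≟ₛ ⊥
... | yes T∩U≡⊥ = U , disjoint-∪ˡ S∩U≡⊥ T∩U≡⊥ , ∣U∣≢1 , λ _ → refl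
... | no T∩U≢⊥  = ⊥ , ∩-zeroʳ (S ∪ T) , ∣⊥∣≢1 {n} , λ x → begin
  monomial T x ∧ powerSum U x  ≡⟨ cong (monomial T x ∧_) (powerSum-nonempty x U≢⊥) ⟩
  monomial T x ∧ meets U x     ≡⟨ monomial-absorbs-meets T U x T∩U≢⊥ ⟩
  monomial T x                 ≡⟨ sym (∧-identityʳ (monomial T x)) ⟩
  monomial T x ∧ true          ≡⟨ cong (monomial T x ∧_) (sym (powerSum-empty x refl)) ⟩
  monomial T x ∧ powerSum ⊥ x  ∎
  where
  open ≡-Reasoning
  U≢⊥ : ¬ (U ≡ ⊥)
  U≢⊥ refl = T∩U≢⊥ (∩-zeroʳ T)

powerTermShape-product : ∀ {n} {f g : Vec Bool n → Bool} →
  PowerTermShape f → PowerTermShape g → Representable (λ x → f x ∧ g x)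
powerTermShape-product {f = f} {g} (shape S U S∩U≡⊥ ∣U∣≢1 f≗) (shape T V T∩V≡⊥ ∣V∣≢1 g≗)
  with absorbMonomial T S∩U≡⊥ ∣U∣≢1 | absorbMonomial S T∩V≡⊥ ∣V∣≢1
... | U′ , dU′ , cU′ , hU | V′ , dV′ , cV′ , hV =
  representable-≗ (sameBase-product U′ V′ dU′ (subst (λ R → R ∩ V′ ≡ ⊥) (∪-comm T S) dV′) cU′ cV′)
  λ x → begin
    monomial (S ∪ T) x ∧ (powerSum U′ x ∧ powerSum V′ x)
      ≡⟨ cong (_∧ (powerSum U′ x ∧ powerSum V′ x)) (monomial-∪ S T x) ⟩
    (monomial S x ∧ monomial T x) ∧ (powerSum U′ x ∧ powerSum V′ x)
      ≡⟨ sym (interchange (monomial S x) (monomial T x) (hU x) (hV x)) ⟩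
    (monomial S x ∧ powerSum U x) ∧ (monomial T x ∧ powerSum V x)
      ≡⟨ sym (cong₂ _∧_ (f≗ x) (g≗ x)) ⟩
    f x ∧ g x ∎
  where
  open ≡-Reasoning
  interchange : ∀ s t {u u′ v v′} → t ∧ u ≡ t ∧ u′ → s ∧ v ≡ s ∧ v′ →
    (s ∧ u) ∧ (t ∧ v) ≡ (s ∧ t) ∧ (u′ ∧ v′)
  interchange true  true  u≡u′ v≡v′ = cong₂ _∧_ u≡u′ v≡v′
  interchange true  false {u} _ _   = ∧-zeroʳ u
  interchange false t         _ _   = refl

product-representable : ∀ {n} {f g : Vec Bool n → Bool} →
  (∀ x → f x ≡ false) ⊎ PowerTermShape f → (∀ x → g x ≡ false) ⊎ PowerTermShape g →
  Representable (λ x → f x ∧ g x)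
product-representable {g = g} (inj₁ f≗0) _ = [] , z≤n , λ x → sym (cong (_∧ g x) (f≗0 x))
product-representable {f = f} (inj₂ _) (inj₁ g≗0) =
  [] , z≤n , λ x → sym (trans (cong (f x ∧_) (g≗0 x)) (∧-zeroʳ (f x)))
product-representable (inj₂ sf) (inj₂ sg) = powerTermShape-product sf sg

mainTheorem4 : (n : ℕ) (e f : Atom n) →
    ∃[ π ] ((length π ≤ 3) × (⟦ π ⟧ ≈ₚ (⟦ e ⟧ₐ ·ₚ ⟦ f ⟧ₐ)))
mainTheorem4 n e f with product-representable (atomShape e) (atomShape f)
... | π , |π|≤3 , π≗ef = π , |π|≤3 ,
  eval-injective ⟦ π ⟧ (⟦ e ⟧ₐ ·ₚ ⟦ f ⟧ₐ) λ x → trans (π≗ef x) (sym (eval-·ₚ ⟦ e ⟧ₐ ⟦ f ⟧ₐ x))
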